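{- Let $(A,+)$ be an abelian group and $u,v$ finite nonempty sequences over $A$ such that $f^0_0(u)=f^0_0(v)$ and $f^1_0(u)=f^1_0(v)$ (i.e., $u$ and $v$ have the same first term and the same multiset of terms). Then $f^r_\gamma(u)=f^r_\gamma(v)$ for every $r\ge 0$ and every $\gamma\in A$.
   Context: For $r\ge 0$, $\gamma\in A$ and a sequence $x_1\dots x_l$ over $A$, $f^r_\gamma(x_1\dots x_l)$ is the multiset $\{x_{a_1}+\dots+x_{a_r}-(r-1)x_1+\gamma : 1\le a_1\le\dots\le a_r\le l\}$ (one element per weakly increasing $r$-tuple of indices); so $f^0_0(x_1\dots x_l)=\{x_1\}$ and $f^1_0(x_1\dots x_l)=\{x_1,\dots,x_l\}$. -}

module Defs where

open import Level using (Level)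
open import Data.Nat using (ℕ; zero; suc)
open import Data.List using (List; []; _∷_; map; _++_; foldr)
open import Algebra.Bundles using (AbelianGroup)
import Data.List.Relation.Binary.Permutation.Setoid as PermS

-- All weakly increasing r-tuples of positions of a list, returned as the
-- corresponding lists of entries (x_{a_1}, ..., x_{a_r}) with a_1 ≤ ... ≤ a_r.
-- One output per index tuple (so it is a multiset, with multiplicities).
multichoose : ∀ {a} {X : Set a} → ℕ → List X → List (List X)
multichoose zero    xs       = [] ∷ []
multichoose (suc r) []       = []
multichoose (suc r) (x ∷ xs) = map (x ∷_) (multichoose r (x ∷ xs)) ++ multichoose (suc r) xs

module _ {c ℓ} (G : AbelianGroup c ℓ) where
  open AbelianGroup G

  Σ : List Carrier → Carrier
  Σ = foldr _∙_ ε

  _×g_ : ℕ → Carrier → Carrier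
  zero  ×g x = ε
  suc n ×g x = x ∙ (n ×g x)

  -- f^r_γ(x₁ x₂ … x_l), for the nonempty sequence given as x₁ ∷ xs:
  -- the multiset { x_{a_1}+…+x_{a_r} − (r−1)x₁ + γ : 1 ≤ a_1 ≤ … ≤ a_r ≤ l },
  -- where −(r−1)x₁ is written as x₁ − r·x₁ (so r = 0 gives +x₁).
  f : ℕ → Carrier → Carrier → List Carrier → List Carrier
  f r γ x₁ xs = map (λ s → ((Σ s ∙ (r ×g x₁) ⁻¹) ∙ x₁) ∙ γ) (multichoose r (x₁ ∷ xs))

  _≋ₘ_ : List Carrier → List Carrier → Set (c Level.⊔ ℓ)
  _≋ₘ_ = PermS._↭_ setoid

-- Every element of f^r_γ(x₁ … x_l) is obtained from an r-fold sum of entries by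
-- the same translation, which depends only on r, γ and x₁. The multiset of r-fold
-- sums of the entries (with repetition) is invariant under permuting the entries;
-- since f^0_0 determines x₁ and f^1_0 is the multiset of entries, both ingredients
-- agree for u and v.
module Submission where

open import Defs
open import Data.Nat using (ℕ; zero; suc)
open import Data.List using (List; []; _∷_; [_]; map; _++_)
open import Data.List.Properties using (map-++; map-∘)
import Data.List.Properties as List
open import Data.List.Relation.Unary.Any using (here)
import Data.List.Relation.Binary.Pointwise as Pointwise
import Data.List.Relation.Binary.Equality.Setoid as SetoidEquality
import Data.List.Relation.Binary.Permutation.Setoid as Permutation
import Data.List.Relation.Binary.Permutation.Setoid.Properties as PermutationProperties
open import Algebra.Bundles using (AbelianGroup; CommutativeMonoid)
open import Relation.Binary.Bundles using (Setoid)
open import Relation.Binary.PropositionalEquality as ≡ using (_≡_)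
import Relation.Binary.Reasoning.Setoid as ≈-Reasoning
open import Function using (_∘_)

module _ {a ℓ} (S : Setoid a ℓ) where
  open Setoid S
  open Permutation S using (_↭_)
  open PermutationProperties S using (∈-resp-↭)

  ↭-singleton⇒≈ : ∀ {x y} → [ x ] ↭ [ y ] → x ≈ y
  ↭-singleton⇒≈ p with ∈-resp-↭ p (here refl)
  ... | here x≈y = x≈y

module _ {a b ℓ₁ ℓ₂} (S : Setoid a ℓ₁) (T : Setoid b ℓ₂) where
  open Setoid S using () renaming (Carrier to A; _≈_ to _≈₁_; refl to refl₁)
  open Setoid T using () renaming (Carrier to B; _≈_ to _≈₂_; trans to trans₂; sym to sym₂)
  open Permutation S using () renaming (_↭_ to _↭₁_)
  open Permutation T using (↭-trans; ↭-reflexive-≋) renaming (_↭_ to _↭₂_)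

  map-resp-↭ : ∀ {g h : A → B} → (∀ {x y} → x ≈₁ y → g x ≈₂ h y) →
               ∀ {xs ys} → xs ↭₁ ys → map g xs ↭₂ map h ys
  map-resp-↭ {g} {h} g≈h xs↭ys =
    ↭-trans (PermutationProperties.map⁺ S T (λ x≈y → trans₂ (g≈h x≈y) (sym₂ (g≈h refl₁))) xs↭ys)
            (↭-reflexive-≋ (Pointwise.map⁺ g h (Pointwise.refl (g≈h refl₁))))

module MultisetSums {c ℓ} (M : CommutativeMonoid c ℓ) where
  open CommutativeMonoid M
  open SetoidEquality setoid using (_≋_; []; _∷_)
  open Permutation setoid
    using (_↭_; prep; swap; ↭-refl; ↭-trans; ↭-swap; ↭-reflexive-≋; module PermutationReasoning)
    renaming (refl to pointwise; trans to composite)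
  open PermutationProperties setoid using (++⁺; ++⁺ʳ; shifts)
  open import Algebra.Properties.CommutativeSemigroup commutativeSemigroup using (x∙yz≈y∙xz)

  sums : ℕ → List Carrier → List Carrier
  sums zero    _        = ε ∷ []
  sums (suc r) []       = []
  sums (suc r) (x ∷ xs) = map (x ∙_) (sums r (x ∷ xs)) ++ sums (suc r) xs

  map-∙-comm : ∀ x y zs → map (x ∙_) (map (y ∙_) zs) ≋ map (y ∙_) (map (x ∙_) zs)
  map-∙-comm x y []       = []
  map-∙-comm x y (z ∷ zs) = x∙yz≈y∙xz x y z ∷ map-∙-comm x y zs

  map-∙-resp-↭ : ∀ {x y xs ys} → x ≈ y → xs ↭ ys → map (x ∙_) xs ↭ map (y ∙_) ys
  map-∙-resp-↭ x≈y = map-resp-↭ setoid setoid (∙-cong x≈y)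

  sums-∷⁺ : ∀ {x y xs ys} → x ≈ y → (∀ r → sums r xs ↭ sums r ys) →
            ∀ r → sums r (x ∷ xs) ↭ sums r (y ∷ ys)
  sums-∷⁺ x≈y h zero    = ↭-refl
  sums-∷⁺ x≈y h (suc r) = ++⁺ (map-∙-resp-↭ x≈y (sums-∷⁺ x≈y h r)) (h (suc r))

  sums-swap : ∀ x y zs r → sums r (x ∷ y ∷ zs) ↭ sums r (y ∷ x ∷ zs)
  sums-swap x y zs zero          = ↭-refl
  sums-swap x y zs (suc zero)    = ↭-swap _ _ ↭-refl
  sums-swap x y zs (suc (suc r)) = begin
      x· (sums (suc r) (x ∷ y ∷ zs)) ++ y· B ++ C  ↭⟨ ++⁺ʳ _ (map-∙-resp-↭ refl (sums-swap x y zs (suc r))) ⟩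
      x· (y· A′ ++ B′) ++ y· B ++ C                ≡⟨ ≡.cong (_++ y· B ++ C) (map-++ (x ∙_) (y· A′) B′) ⟩
      (x· (y· A′) ++ x· B′) ++ y· B ++ C           ≡⟨ List.++-assoc (x· (y· A′)) (x· B′) (y· B ++ C) ⟩
      x· (y· A′) ++ x· B′ ++ y· B ++ C             ↭⟨ ++⁺ x·y·A′↭y·x·A (shifts (x· B′) (y· B)) ⟩
      y· (x· A) ++ y· B ++ x· B′ ++ C              ≡⟨ List.++-assoc (y· (x· A)) (y· B) (x· B′ ++ C) ⟨
      (y· (x· A) ++ y· B) ++ x· B′ ++ C            ≡⟨ ≡.cong (_++ x· B′ ++ C) (map-++ (y ∙_) (x· A) B) ⟨
      y· (x· A ++ B) ++ x· B′ ++ C                 ↭⟨ ++⁺ʳ _ (map-∙-resp-↭ refl (sums-swap x y zs (suc r))) ⟩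
      y· (sums (suc r) (y ∷ x ∷ zs)) ++ x· B′ ++ C ∎
    where
    open PermutationReasoning
    x· y· : List Carrier → List Carrier
    x· = map (x ∙_)
    y· = map (y ∙_)
    A = sums r (x ∷ y ∷ zs)
    A′ = sums r (y ∷ x ∷ zs)
    B = sums (suc r) (y ∷ zs)
    B′ = sums (suc r) (x ∷ zs)
    C = sums (suc (suc r)) zs
    x·y·A′↭y·x·A : x· (y· A′) ↭ y· (x· A)
    x·y·A′↭y·x·A = ↭-trans (↭-reflexive-≋ (map-∙-comm x y A′))
                           (map-∙-resp-↭ refl (map-∙-resp-↭ refl (sums-swap y x zs r)))

  sums-resp-≋ : ∀ {xs ys} → xs ≋ ys → ∀ r → sums r xs ↭ sums r ys
  sums-resp-≋ []            r = ↭-refl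
  sums-resp-≋ (x≈y ∷ xs≋ys) r = sums-∷⁺ x≈y (sums-resp-≋ xs≋ys) r

  sums-resp-↭ : ∀ {xs ys} → xs ↭ ys → ∀ r → sums r xs ↭ sums r ys
  sums-resp-↭ (pointwise xs≋ys)   r = sums-resp-≋ xs≋ys r
  sums-resp-↭ (prep x≈y xs↭ys)    r = sums-∷⁺ x≈y (sums-resp-↭ xs↭ys) r
  sums-resp-↭ (swap {xs} {_} {x} {y} x≈x′ y≈y′ xs↭ys) r =
    ↭-trans (sums-swap x y xs r) (sums-∷⁺ y≈y′ (sums-∷⁺ x≈x′ (sums-resp-↭ xs↭ys)) r)
  sums-resp-↭ (composite xs↭ys ys↭zs) r = ↭-trans (sums-resp-↭ xs↭ys r) (sums-resp-↭ ys↭zs r)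

module _ {c ℓ} (G : AbelianGroup c ℓ) where
  open AbelianGroup G
  open SetoidEquality setoid using (_≋_; []; _∷_)
  open Permutation setoid using (_↭_)
  open MultisetSums commutativeMonoid using (sums)

  map-Σ-multichoose : ∀ r xs → map (Σ G) (multichoose r xs) ≡ sums r xs
  map-Σ-multichoose zero    xs       = ≡.refl
  map-Σ-multichoose (suc r) []       = ≡.refl
  map-Σ-multichoose (suc r) (x ∷ xs) = begin
    map (Σ G) (map (x ∷_) M ++ M′)              ≡⟨ map-++ (Σ G) (map (x ∷_) M) M′ ⟩
    map (Σ G) (map (x ∷_) M) ++ map (Σ G) M′    ≡⟨ ≡.cong (_++ map (Σ G) M′) (map-∘ M) ⟨
    map ((x ∙_) ∘ Σ G) M ++ map (Σ G) M′        ≡⟨ ≡.cong (_++ map (Σ G) M′) (map-∘ M) ⟩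
    map (x ∙_) (map (Σ G) M) ++ map (Σ G) M′    ≡⟨ ≡.cong₂ (λ s t → map (x ∙_) s ++ t)
                                                     (map-Σ-multichoose r (x ∷ xs))
                                                     (map-Σ-multichoose (suc r) xs) ⟩
    map (x ∙_) (sums r (x ∷ xs)) ++ sums (suc r) xs ∎
    where
    open ≡.≡-Reasoning
    M = multichoose r (x ∷ xs)
    M′ = multichoose (suc r) xs

  translate : ℕ → Carrier → Carrier → Carrier → Carrier
  translate r γ x₁ s = ((s ∙ (_×g_ G r x₁) ⁻¹) ∙ x₁) ∙ γ

  f-via-sums : ∀ r γ x₁ xs → f G r γ x₁ xs ≡ map (translate r γ x₁) (sums r (x₁ ∷ xs))
  f-via-sums r γ x₁ xs =
    ≡.trans (map-∘ (multichoose r (x₁ ∷ xs))) (≡.cong (map (translate r γ x₁)) (map-Σ-multichoose r (x₁ ∷ xs)))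

  ×g-cong : ∀ n {x y} → x ≈ y → _×g_ G n x ≈ _×g_ G n y
  ×g-cong zero    x≈y = refl
  ×g-cong (suc n) x≈y = ∙-cong x≈y (×g-cong n x≈y)

  translate-cong : ∀ r γ {x y s t} → x ≈ y → s ≈ t → translate r γ x s ≈ translate r γ y t
  translate-cong r γ x≈y s≈t = ∙-congʳ (∙-cong (∙-cong s≈t (⁻¹-cong (×g-cong r x≈y))) x≈y)

  translate-0-ε : ∀ x → translate 0 ε x ε ≈ x
  translate-0-ε x = begin
    ((ε ∙ ε ⁻¹) ∙ x) ∙ ε  ≈⟨ identityʳ _ ⟩
    (ε ∙ ε ⁻¹) ∙ x        ≈⟨ ∙-congʳ (inverseʳ ε) ⟩
    ε ∙ x                 ≈⟨ identityˡ x ⟩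
    x                     ∎
    where open ≈-Reasoning setoid

  translate-1-ε : ∀ x s → translate 1 ε x s ≈ s
  translate-1-ε x s = begin
    ((s ∙ (x ∙ ε) ⁻¹) ∙ x) ∙ ε  ≈⟨ identityʳ _ ⟩
    (s ∙ (x ∙ ε) ⁻¹) ∙ x        ≈⟨ ∙-congʳ (∙-congˡ (⁻¹-cong (identityʳ x))) ⟩
    (s ∙ x ⁻¹) ∙ x              ≈⟨ assoc s (x ⁻¹) x ⟩
    s ∙ (x ⁻¹ ∙ x)              ≈⟨ ∙-congˡ (inverseˡ x) ⟩
    s ∙ ε                       ≈⟨ identityʳ s ⟩
    s                           ∎
    where open ≈-Reasoning setoid

  f⁰-first : ∀ x₁ xs → f G 0 ε x₁ xs ≋ [ x₁ ]
  f⁰-first x₁ xs = translate-0-ε x₁ ∷ []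

  map-translate-1-multichoose-1 : ∀ x ys → map (translate 1 ε x ∘ Σ G) (multichoose 1 ys) ≋ ys
  map-translate-1-multichoose-1 x []       = []
  map-translate-1-multichoose-1 x (y ∷ ys) =
    trans (translate-1-ε x (y ∙ ε)) (identityʳ y) ∷ map-translate-1-multichoose-1 x ys

  f¹-entries : ∀ x₁ xs → f G 1 ε x₁ xs ≋ x₁ ∷ xs
  f¹-entries x₁ xs = map-translate-1-multichoose-1 x₁ (x₁ ∷ xs)

  f-cong : ∀ r γ {x₁ y₁ xs ys} → x₁ ≈ y₁ → sums r (x₁ ∷ xs) ↭ sums r (y₁ ∷ ys) →
           _≋ₘ_ G (f G r γ x₁ xs) (f G r γ y₁ ys)
  f-cong r γ {x₁} {y₁} {xs} {ys} x₁≈y₁ sums↭ = begin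
    f G r γ x₁ xs                              ≡⟨ f-via-sums r γ x₁ xs ⟩
    map (translate r γ x₁) (sums r (x₁ ∷ xs))  ↭⟨ map-resp-↭ setoid setoid (translate-cong r γ x₁≈y₁) sums↭ ⟩
    map (translate r γ y₁) (sums r (y₁ ∷ ys))  ≡⟨ f-via-sums r γ y₁ ys ⟨
    f G r γ y₁ ys                              ∎
    where open Permutation.PermutationReasoning setoid

lemma2p6 : ∀ {c ℓ} (G : AbelianGroup c ℓ) →
    let open AbelianGroup G in
    (x₁ : Carrier) (xs : List Carrier) (y₁ : Carrier) (ys : List Carrier) →
    _≋ₘ_ G (f G 0 ε x₁ xs) (f G 0 ε y₁ ys) →
    _≋ₘ_ G (f G 1 ε x₁ xs) (f G 1 ε y₁ ys) →
    (r : ℕ) (γ : Carrier) →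
    _≋ₘ_ G (f G r γ x₁ xs) (f G r γ y₁ ys)
lemma2p6 G x₁ xs y₁ ys f⁰↭ f¹↭ r γ = f-cong G r γ x₁≈y₁ (sums-resp-↭ entries↭ r)
  where
  open AbelianGroup G using (_≈_; setoid; commutativeMonoid)
  open Permutation setoid using (_↭_)
  open PermutationProperties setoid using (↭-respˡ-≋; ↭-respʳ-≋)
  open MultisetSums commutativeMonoid using (sums-resp-↭)
  x₁≈y₁ : x₁ ≈ y₁
  x₁≈y₁ = ↭-singleton⇒≈ setoid (↭-respˡ-≋ (f⁰-first G x₁ xs) (↭-respʳ-≋ (f⁰-first G y₁ ys) f⁰↭))
  entries↭ : x₁ ∷ xs ↭ y₁ ∷ ys
  entries↭ = ↭-respˡ-≋ (f¹-entries G x₁ xs) (↭-respʳ-≋ (f¹-entries G y₁ ys) f¹↭)
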